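{- For $k\ge 2$, let $H_k$ be the fan $K_1\vee P_k$. Then $\mathcal{I}(\overline{H_k})\cong\mathcal{A}(\overline{H_k})\cong P_{k-1}$.
   Context: $P_m$ is the path on $m$ vertices; $\overline{H}$ denotes the complement of $H$; $\vee$ denotes the join. For a graph $G$, an $i$-set is an independent dominating set of minimum cardinality and an $\alpha$-set is a maximum independent set. The $i$-graph $\mathcal{I}(G)$ has the $i$-sets as vertices, with $X\sim Y$ iff $Y=(X\setminus\{u\})\cup\{v\}$ for some $u\in X$, $v\notin X$ with $uv\in E(G)$; the $\alpha$-graph $\mathcal{A}(G)$ is defined the same way on the $\alpha$-sets. -}

module Defs where

open import Data.Nat using (ℕ; suc; _+_; _≤_)
open import Data.Fin using (Fin; toℕ; splitAt)
open import Data.Fin.Subset using (Subset; _∈_; _∉_; ∣_∣; inside; outside)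
open import Data.Vec using (_[_]≔_)
open import Data.Sum using (_⊎_; inj₁; inj₂)
open import Data.Product using (Σ; ∃; ∃-syntax; _×_)
open import Data.Unit using (⊤)
open import Data.Empty using (⊥)
open import Relation.Nullary using (¬_)
open import Relation.Binary.PropositionalEquality using (_≡_; _≢_)
open import Function.Bundles using (_⇔_)
open import Function.Definitions using (Injective)

Graph : ℕ → Set₁
Graph n = Fin n → Fin n → Set

path : (m : ℕ) → Graph m
path m i j = (suc (toℕ i) ≡ toℕ j) ⊎ (suc (toℕ j) ≡ toℕ i)

K₁ : Graph 1
K₁ _ _ = ⊥

compl : ∀ {n} → Graph n → Graph n
compl G u v = ¬ G u v × u ≢ v

joinAdj : ∀ {m n} → Graph m → Graph n → (Fin m ⊎ Fin n) → (Fin m ⊎ Fin n) → Set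
joinAdj G H (inj₁ a) (inj₁ b) = G a b
joinAdj G H (inj₂ a) (inj₂ b) = H a b
joinAdj G H (inj₁ a) (inj₂ b) = ⊤
joinAdj G H (inj₂ a) (inj₁ b) = ⊤

join : ∀ {m n} → Graph m → Graph n → Graph (m + n)
join {m} G H u v = joinAdj G H (splitAt m u) (splitAt m v)

fan : (k : ℕ) → Graph (1 + k)
fan k = join K₁ (path k)

module _ {n : ℕ} (G : Graph n) where

  Independent : Subset n → Set
  Independent S = ∀ u v → u ∈ S → v ∈ S → ¬ G u v

  Dominating : Subset n → Set
  Dominating S = ∀ v → v ∈ S ⊎ (∃[ u ] (u ∈ S × G u v))

  IndepDom : Subset n → Set
  IndepDom S = Independent S × Dominating S

  IsISet : Subset n → Set
  IsISet S = IndepDom S × (∀ T → IndepDom T → ∣ S ∣ ≤ ∣ T ∣)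

  IsAlphaSet : Subset n → Set
  IsAlphaSet S = Independent S × (∀ T → Independent T → ∣ T ∣ ≤ ∣ S ∣)

  Slide : Subset n → Subset n → Set
  Slide X Y = ∃[ u ] ∃[ v ] (u ∈ X × v ∉ X × G u v × Y ≡ ((X [ u ]≔ outside) [ v ]≔ inside))

  ReconfIsoPath : (Subset n → Set) → ℕ → Set
  ReconfIsoPath P m =
    Σ (Fin m → Subset n) λ f →
      (∀ j → P (f j)) ×
      Injective _≡_ _≡_ f ×
      (∀ X → P X → ∃[ j ] (f j ≡ X)) ×
      (∀ i j → path m i j ⇔ Slide (f i) (f j))

-- In the complement of the fan K₁ ∨ P_k the hub is isolated and the rim
-- induces the complement of P_k, so an independent set is the hub (or not)
-- together with a clique of P_k: nothing, one vertex, or an edge {i, i+1}.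
-- An isolated vertex must lie in every dominating set, and a single rim vertex
-- fails to dominate its path-neighbour, so the independent dominating sets are
-- exactly the sets {hub, i, i+1}; all have size 3, which is also the largest
-- size of an independent set. Two such sets differ by one slide exactly when
-- their edges share a vertex, i.e. when their indices are adjacent in P_{k-1}.
module Submission where

open import Defs
open import Data.Nat using (ℕ; zero; suc; _≤_; _∸_; z≤n; s≤s; s≤s⁻¹)
import Data.Nat.Properties as ℕ
open import Data.Bool using (Bool)
open import Data.Fin using (Fin; zero; suc; toℕ; inject₁)
import Data.Fin.Properties as Fin
open import Data.Fin.Subset using (Subset; _∈_; ∣_∣; inside; outside; ⁅_⁆) renaming (⊥ to ∅)
open import Data.Fin.Subset.Properties using (∉⊥; x∈⁅x⁆; x∈⁅y⁆⇒x≡y; ∣⊥∣≡0; ∣⁅x⁆∣≡1)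
open import Data.Vec using ([]; _∷_; here; there)
open import Data.Vec.Properties using (∷-injectiveʳ; []≔-updates; []≔-minimal)
import Data.Sum as Sum
open import Data.Sum using (_⊎_; inj₁; inj₂)
import Data.Product as Product
open import Data.Product using (∃-syntax; _×_; _,_; proj₁)
open import Data.Unit using (tt)
open import Data.Empty using (⊥-elim)
open import Function using (_∘_)
open import Function.Bundles using (_⇔_; mk⇔)
open import Function.Construct.Composition using (_⇔-∘_)
open import Function.Definitions using (Injective)
open import Relation.Nullary using (¬_; contradiction)
open import Relation.Binary.PropositionalEquality using (_≡_; _≢_; refl; sym; trans; cong; subst)

private variable
  k n : ℕ
  b : Bool
  P Q X : Subset n

path-suc⁺ : {i j : Fin n} → path n i j → path (suc n) (suc i) (suc j)
path-suc⁺ = Sum.map (cong suc) (cong suc)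

path-suc⁻ : {i j : Fin n} → path (suc n) (suc i) (suc j) → path n i j
path-suc⁻ = Sum.map ℕ.suc-injective ℕ.suc-injective

path-irrefl : {i : Fin n} → ¬ path n i i
path-irrefl = Sum.[ ℕ.1+n≢n , ℕ.1+n≢n ]

¬path-zero-suc-suc : {i : Fin n} → ¬ path (suc (suc n)) zero (suc (suc i))
¬path-zero-suc-suc (inj₁ ())
¬path-zero-suc-suc (inj₂ ())

path-neighbour : (i : Fin (suc (suc n))) → ∃[ j ] path (suc (suc n)) i j
path-neighbour zero    = suc zero , inj₁ refl
path-neighbour (suc i) = inject₁ i , inj₂ (cong suc (Fin.toℕ-inject₁ i))

compl-path-suc⁺ : {i j : Fin n} → compl (path n) i j → compl (path (suc n)) (suc i) (suc j)
compl-path-suc⁺ (¬i~j , i≢j) = ¬i~j ∘ path-suc⁻ , i≢j ∘ Fin.suc-injective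

compl-path-suc⁻ : {i j : Fin n} → compl (path (suc n)) (suc i) (suc j) → compl (path n) i j
compl-path-suc⁻ (¬i~j , i≢j) = ¬i~j ∘ path-suc⁺ , i≢j ∘ cong suc

independent-tail : Independent (compl (path (suc n))) (b ∷ P) → Independent (compl (path n)) P
independent-tail ind u v u∈ v∈ = ind (suc u) (suc v) (there u∈) (there v∈) ∘ compl-path-suc⁺

independent-outside∷ : Independent (compl (path n)) P → Independent (compl (path (suc n))) (outside ∷ P)
independent-outside∷ ind (suc u) (suc v) (there u∈) (there v∈) = ind u v u∈ v∈ ∘ compl-path-suc⁻

slide-∷ : Slide (compl (path n)) P Q → Slide (compl (path (suc n))) (b ∷ P) (b ∷ Q)
slide-∷ {b = b} (u , v , u∈ , v∉ , u~v , Q≡) =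
  suc u , suc v , there u∈ , (λ { (there v∈) → v∉ v∈ }) , compl-path-suc⁺ u~v , cong (b ∷_) Q≡

edge : Fin n → Subset (suc n)
edge zero    = inside ∷ inside ∷ ∅
edge (suc i) = outside ∷ edge i

suc∈edge : (i : Fin n) → suc i ∈ edge i
suc∈edge zero    = there here
suc∈edge (suc i) = there (suc∈edge i)

inject₁∈edge : (i : Fin n) → inject₁ i ∈ edge i
inject₁∈edge zero    = here
inject₁∈edge (suc i) = there (inject₁∈edge i)

∈edge⇒ : (i : Fin n) {w : Fin (suc n)} → w ∈ edge i → toℕ w ≡ toℕ i ⊎ toℕ w ≡ suc (toℕ i)
∈edge⇒ zero    here                = inj₁ refl
∈edge⇒ zero    (there here)        = inj₂ refl
∈edge⇒ zero    (there (there w∈∅)) = contradiction w∈∅ ∉⊥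
∈edge⇒ (suc i) {suc w} (there w∈)  = Sum.map (cong suc) (cong suc) (∈edge⇒ i w∈)

∣edge∣≡2 : (i : Fin n) → ∣ edge i ∣ ≡ 2
∣edge∣≡2 {suc n} zero = cong (λ s → suc (suc s)) (∣⊥∣≡0 n)
∣edge∣≡2 (suc i)      = ∣edge∣≡2 i

edge-injective : Injective _≡_ _≡_ (edge {n})
edge-injective {x = zero}  {zero}  _  = refl
edge-injective {x = suc i} {suc j} eq = cong suc (edge-injective (∷-injectiveʳ eq))

edge-other : (i : Fin n) {u : Fin (suc n)} → u ∈ edge i → ∃[ w ] (w ∈ edge i × w ≢ u)
edge-other i u∈ with ∈edge⇒ i u∈
... | inj₁ u≡i   = suc i , suc∈edge i , λ w≡u → ℕ.1+n≢n (trans (cong toℕ w≡u) u≡i)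
... | inj₂ u≡1+i = inject₁ i , inject₁∈edge i ,
  λ w≡u → ℕ.1+n≢n (sym (trans (sym (Fin.toℕ-inject₁ i)) (trans (cong toℕ w≡u) u≡1+i)))

edges-meet⇒path : {i j : Fin n} {w : Fin (suc n)} → w ∈ edge i → w ∈ edge j → i ≢ j → path n i j
edges-meet⇒path {i = i} {j} w∈i w∈j i≢j with ∈edge⇒ i w∈i | ∈edge⇒ j w∈j
... | inj₁ w≡i   | inj₁ w≡j   = contradiction (Fin.toℕ-injective (trans (sym w≡i) w≡j)) i≢j
... | inj₁ w≡i   | inj₂ w≡1+j = inj₂ (trans (sym w≡1+j) w≡i)
... | inj₂ w≡1+i | inj₁ w≡j   = inj₁ (trans (sym w≡1+i) w≡j)
... | inj₂ w≡1+i | inj₂ w≡1+j =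
  contradiction (Fin.toℕ-injective (ℕ.suc-injective (trans (sym w≡1+i) w≡1+j))) i≢j

edge-independent : (i : Fin n) → Independent (compl (path (suc n))) (edge i)
edge-independent zero zero       zero       here         here         (_ , 0≢0) = 0≢0 refl
edge-independent zero zero       (suc zero) here         (there here) (¬0~1 , _) = ¬0~1 (inj₁ refl)
edge-independent zero (suc zero) zero       (there here) here         (¬1~0 , _) = ¬1~0 (inj₂ refl)
edge-independent zero (suc zero) (suc zero) (there here) (there here) (_ , 1≢1) = 1≢1 refl
edge-independent zero (suc (suc _)) _ (there (there u∈∅)) _ = contradiction u∈∅ ∉⊥
edge-independent zero _ (suc (suc _)) _ (there (there v∈∅)) = contradiction v∈∅ ∉⊥
edge-independent (suc i) = independent-outside∷ (edge-independent i)

edge-dominating : (i : Fin n) → Dominating (compl (path (suc n))) (edge i)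
edge-dominating zero    zero             = inj₁ here
edge-dominating zero    (suc zero)       = inj₁ (there here)
edge-dominating zero    (suc (suc _))    = inj₂ (zero , here , ¬path-zero-suc-suc , λ ())
edge-dominating (suc i) zero             =
  inj₂ (suc (suc i) , there (suc∈edge i) , (λ { (inj₁ ()) ; (inj₂ ()) }) , λ ())
edge-dominating (suc i) (suc v)          =
  Sum.map there (λ (u , u∈ , u~v) → suc u , there u∈ , compl-path-suc⁺ u~v) (edge-dominating i v)

path⇒slide-edge : (i j : Fin n) → path n i j → Slide (compl (path (suc n))) (edge i) (edge j)
path⇒slide-edge {n} zero zero 0~0 = contradiction 0~0 (path-irrefl {n} {zero})
path⇒slide-edge {suc (suc n)} zero (suc zero) (inj₁ refl) =
  zero , suc (suc zero) , here , (λ { (there (there ())) }) , (¬path-zero-suc-suc {i = zero {n}} , λ ()) , refl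
path⇒slide-edge (suc zero) zero (inj₂ refl) =
  suc (suc zero) , zero , there (there here) , (λ ()) , ((λ { (inj₁ ()) ; (inj₂ ()) }) , λ ()) , refl
path⇒slide-edge zero          (suc (suc _)) (inj₁ ())
path⇒slide-edge zero          (suc _)       (inj₂ ())
path⇒slide-edge (suc _)       zero          (inj₁ ())
path⇒slide-edge (suc (suc _)) zero          (inj₂ ())
path⇒slide-edge (suc i) (suc j) 1+i~1+j = slide-∷ (path⇒slide-edge i j (path-suc⁻ 1+i~1+j))

-- The vertex of edge i other than the removed u stays, so it lies in both edges.
slide-edge⇒path : (i j : Fin n) → Slide (compl (path (suc n))) (edge i) (edge j) → path n i j
slide-edge⇒path i j (u , v , u∈ , v∉ , _ , edge-j≡) with edge-other i u∈
... | w , w∈i , w≢u = edges-meet⇒path w∈i w∈j i≢j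
  where
  w∈j : w ∈ edge j
  w∈j = subst (w ∈_) (sym edge-j≡)
    ([]≔-minimal _ w v (λ w≡v → v∉ (subst (_∈ edge i) w≡v w∈i)) ([]≔-minimal _ w u w≢u w∈i))

  i≢j : i ≢ j
  i≢j refl = v∉ (subst (v ∈_) (sym edge-j≡) ([]≔-updates _ v))

path⇔slide-edge : (i j : Fin n) → path n i j ⇔ Slide (compl (path (suc n))) (edge i) (edge j)
path⇔slide-edge i j = mk⇔ (path⇒slide-edge i j) (slide-edge⇒path i j)

-- Independent sets of the complement of a path are the cliques of the path.
data PathClique {n : ℕ} : Subset (suc n) → Set where
  ∅-clique      : PathClique ∅
  vertex-clique : (i : Fin (suc n)) → PathClique ⁅ i ⁆
  edge-clique   : (i : Fin n) → PathClique (edge i)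

pathClique-∷ : PathClique P → Independent (compl (path (suc (suc n)))) (b ∷ P) → PathClique (b ∷ P)
pathClique-∷ {b = outside} ∅-clique             _   = ∅-clique
pathClique-∷ {b = outside} (vertex-clique i)    _   = vertex-clique (suc i)
pathClique-∷ {b = outside} (edge-clique i)      _   = edge-clique (suc i)
pathClique-∷ {b = inside}  ∅-clique             _   = vertex-clique zero
pathClique-∷ {b = inside}  (vertex-clique zero) _   = edge-clique zero
pathClique-∷ {b = inside}  (vertex-clique (suc i)) ind =
  ⊥-elim (ind zero (suc (suc i)) here (there (x∈⁅x⁆ (suc i))) (¬path-zero-suc-suc , λ ()))
pathClique-∷ {b = inside}  (edge-clique i) ind =
  ⊥-elim (ind zero (suc (suc i)) here (there (suc∈edge i)) (¬path-zero-suc-suc , λ ()))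

independent⇒pathClique : (P : Subset (suc n)) → Independent (compl (path (suc n))) P → PathClique P
independent⇒pathClique {zero}  (outside ∷ []) _   = ∅-clique
independent⇒pathClique {zero}  (inside ∷ [])  _   = vertex-clique zero
independent⇒pathClique {suc n} (b ∷ P)       ind =
  pathClique-∷ (independent⇒pathClique P (independent-tail ind)) ind

∣pathClique∣≤2 : {P : Subset (suc n)} → PathClique P → ∣ P ∣ ≤ 2
∣pathClique∣≤2 {n = n} ∅-clique = subst (_≤ 2) (sym (∣⊥∣≡0 n)) z≤n
∣pathClique∣≤2 (vertex-clique i) = subst (_≤ 2) (sym (∣⁅x⁆∣≡1 i)) (s≤s z≤n)
∣pathClique∣≤2 (edge-clique i)   = ℕ.≤-reflexive (∣edge∣≡2 i)

pathClique-2≤∣∣⇒edge : {P : Subset (suc n)} → PathClique P → 2 ≤ ∣ P ∣ → ∃[ i ] edge i ≡ P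
pathClique-2≤∣∣⇒edge {n = n} ∅-clique 2≤∣∅∣ = contradiction (subst (2 ≤_) (∣⊥∣≡0 n) 2≤∣∅∣) λ ()
pathClique-2≤∣∣⇒edge (vertex-clique i) 2≤∣i∣  =
  contradiction (subst (2 ≤_) (∣⁅x⁆∣≡1 i) 2≤∣i∣) λ { (s≤s ()) }
pathClique-2≤∣∣⇒edge (edge-clique i)   _      = i , refl

¬dominating-∅ : ¬ Dominating (compl (path (suc n))) ∅
¬dominating-∅ dom with dom zero
... | inj₁ 0∈∅           = ∉⊥ 0∈∅
... | inj₂ (_ , u∈∅ , _) = ∉⊥ u∈∅

¬dominating-⁅⁆ : (i : Fin (suc (suc n))) → ¬ Dominating (compl (path (suc (suc n)))) ⁅ i ⁆
¬dominating-⁅⁆ i dom with path-neighbour i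
... | j , i~j with dom j
...   | inj₁ j∈ = path-irrefl (subst (path _ i) (x∈⁅y⁆⇒x≡y i j∈) i~j)
...   | inj₂ (u , u∈ , ¬u~j , _) = ¬u~j (subst (λ x → path _ x j) (sym (x∈⁅y⁆⇒x≡y i u∈)) i~j)

indepDom⇒edge : IndepDom (compl (path (suc (suc n)))) P → ∃[ i ] edge i ≡ P
indepDom⇒edge {P = P} (ind , dom) with independent⇒pathClique P ind
... | ∅-clique        = contradiction dom ¬dominating-∅
... | vertex-clique i = contradiction dom (¬dominating-⁅⁆ i)
... | edge-clique i   = i , refl

-- In the fan the hub is adjacent to every other vertex.
hub-isolatedˡ : (v : Fin (suc k)) → ¬ compl (fan k) zero v
hub-isolatedˡ zero    (_ , 0≢0) = 0≢0 refl
hub-isolatedˡ (suc _) (¬⊤ , _)  = ¬⊤ tt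

hub-isolatedʳ : (u : Fin (suc k)) → ¬ compl (fan k) u zero
hub-isolatedʳ zero    (_ , 0≢0) = 0≢0 refl
hub-isolatedʳ (suc _) (¬⊤ , _)  = ¬⊤ tt

compl-fan⇒compl-path : {u v : Fin k} → compl (fan k) (suc u) (suc v) → compl (path k) u v
compl-fan⇒compl-path (¬u~v , u≢v) = ¬u~v , u≢v ∘ cong suc

compl-path⇒compl-fan : {u v : Fin k} → compl (path k) u v → compl (fan k) (suc u) (suc v)
compl-path⇒compl-fan (¬u~v , u≢v) = ¬u~v , u≢v ∘ Fin.suc-injective

fan-independent⁻ : Independent (compl (fan k)) (b ∷ P) → Independent (compl (path k)) P
fan-independent⁻ ind u v u∈ v∈ = ind (suc u) (suc v) (there u∈) (there v∈) ∘ compl-path⇒compl-fan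

fan-independent⁺ : Independent (compl (path k)) P → Independent (compl (fan k)) (b ∷ P)
fan-independent⁺ ind zero    v       _          _          = hub-isolatedˡ v
fan-independent⁺ ind (suc u) zero    _          _          = hub-isolatedʳ (suc u)
fan-independent⁺ ind (suc u) (suc v) (there u∈) (there v∈) = ind u v u∈ v∈ ∘ compl-fan⇒compl-path

fan-dominating⇒hub : Dominating (compl (fan k)) (b ∷ P) → b ≡ inside
fan-dominating⇒hub dom with dom zero
... | inj₁ here          = refl
... | inj₂ (u , _ , u~0) = contradiction u~0 (hub-isolatedʳ u)

fan-dominating⁻ : Dominating (compl (fan k)) (b ∷ P) → Dominating (compl (path k)) P
fan-dominating⁻ dom v with dom (suc v)
... | inj₁ (there v∈)                   = inj₁ v∈
... | inj₂ (zero , _ , 0~v)             = contradiction 0~v (hub-isolatedˡ (suc v))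
... | inj₂ (suc u , there u∈ , u~v)     = inj₂ (u , u∈ , compl-fan⇒compl-path u~v)

fan-dominating⁺ : Dominating (compl (path k)) P → Dominating (compl (fan k)) (inside ∷ P)
fan-dominating⁺ dom zero    = inj₁ here
fan-dominating⁺ dom (suc v) =
  Sum.map there (λ (u , u∈ , u~v) → suc u , there u∈ , compl-path⇒compl-fan u~v) (dom v)

fan-slide⇔ : Slide (compl (path k)) P Q ⇔ Slide (compl (fan k)) (inside ∷ P) (inside ∷ Q)
fan-slide⇔ = mk⇔ lift lower
  where
  lift : Slide (compl (path _)) _ _ → Slide (compl (fan _)) _ _
  lift (u , v , u∈ , v∉ , u~v , Q≡) =
    suc u , suc v , there u∈ , (λ { (there v∈) → v∉ v∈ }) , compl-path⇒compl-fan u~v , cong (inside ∷_) Q≡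

  lower : Slide (compl (fan _)) _ _ → Slide (compl (path _)) _ _
  lower (zero  , v     , _ , _  , 0~v , _) = contradiction 0~v (hub-isolatedˡ v)
  lower (suc u , zero  , _ , 0∉ , _   , _) = contradiction here 0∉
  lower (suc u , suc v , there u∈ , v∉ , u~v , Q≡) =
    u , v , u∈ , v∉ ∘ there , compl-fan⇒compl-path u~v , ∷-injectiveʳ Q≡

-- {hub, i, i+1} in K₁ ∨ P_{n+1}, whose vertex zero is the hub and suc j the rim vertex j.
hubEdge : Fin n → Subset (suc (suc n))
hubEdge i = inside ∷ edge i

∣hubEdge∣≡3 : (i : Fin n) → ∣ hubEdge i ∣ ≡ 3
∣hubEdge∣≡3 i = cong suc (∣edge∣≡2 i)

hubEdge-injective : Injective _≡_ _≡_ (hubEdge {n})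
hubEdge-injective = edge-injective ∘ ∷-injectiveʳ

hubEdge-independent : (i : Fin n) → Independent (compl (fan (suc n))) (hubEdge i)
hubEdge-independent i = fan-independent⁺ (edge-independent i)

hubEdge-indepDom : (i : Fin n) → IndepDom (compl (fan (suc n))) (hubEdge i)
hubEdge-indepDom i = hubEdge-independent i , fan-dominating⁺ (edge-dominating i)

indepDom⇒hubEdge : IndepDom (compl (fan (suc (suc n)))) X → ∃[ i ] hubEdge i ≡ X
indepDom⇒hubEdge {X = b ∷ P} (ind , dom)
  with fan-dominating⇒hub dom | indepDom⇒edge (fan-independent⁻ ind , fan-dominating⁻ dom)
... | refl | i , refl = i , refl

hubEdge-isISet : (i : Fin (suc n)) → IsISet (compl (fan (suc (suc n)))) (hubEdge i)
hubEdge-isISet i = hubEdge-indepDom i , λ T T-indepDom → minimal (indepDom⇒hubEdge T-indepDom)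
  where
  minimal : ∀ {T} → ∃[ j ] hubEdge j ≡ T → ∣ hubEdge i ∣ ≤ ∣ T ∣
  minimal (j , refl) = ℕ.≤-reflexive (trans (∣hubEdge∣≡3 i) (sym (∣hubEdge∣≡3 j)))

fan-independent⇒pathClique : Independent (compl (fan (suc n))) (b ∷ P) → PathClique P
fan-independent⇒pathClique {P = P} = independent⇒pathClique P ∘ fan-independent⁻

∣fan-independent∣≤3 : Independent (compl (fan (suc n))) X → ∣ X ∣ ≤ 3
∣fan-independent∣≤3 {X = outside ∷ _} ind = ℕ.m≤n⇒m≤1+n (∣pathClique∣≤2 (fan-independent⇒pathClique ind))
∣fan-independent∣≤3 {X = inside ∷ _}  ind = s≤s (∣pathClique∣≤2 (fan-independent⇒pathClique ind))

hubEdge-isAlphaSet : (i : Fin n) → IsAlphaSet (compl (fan (suc n))) (hubEdge i)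
hubEdge-isAlphaSet i = hubEdge-independent i ,
  λ T T-independent → subst (∣ T ∣ ≤_) (sym (∣hubEdge∣≡3 i)) (∣fan-independent∣≤3 T-independent)

3≤∣alphaSet∣ : IsAlphaSet (compl (fan (suc (suc n)))) X → 3 ≤ ∣ X ∣
3≤∣alphaSet∣ {n} {X} (_ , maximum) =
  subst (_≤ ∣ X ∣) (∣hubEdge∣≡3 {suc n} zero) (maximum (hubEdge zero) (hubEdge-independent {suc n} zero))

alphaSet⇒hubEdge : IsAlphaSet (compl (fan (suc (suc n)))) X → ∃[ i ] hubEdge i ≡ X
alphaSet⇒hubEdge {X = outside ∷ _} α@(ind , _) =
  contradiction (3≤∣alphaSet∣ α) (ℕ.<⇒≱ (s≤s (∣pathClique∣≤2 (fan-independent⇒pathClique ind))))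
alphaSet⇒hubEdge {X = inside ∷ _}  α@(ind , _) =
  Product.map₂ (cong (inside ∷_)) (pathClique-2≤∣∣⇒edge (fan-independent⇒pathClique ind) (s≤s⁻¹ (3≤∣alphaSet∣ α)))

path⇔slide-hubEdge : (i j : Fin n) → path n i j ⇔ Slide (compl (fan (suc n))) (hubEdge i) (hubEdge j)
path⇔slide-hubEdge i j = fan-slide⇔ ⇔-∘ path⇔slide-edge i j

mainTheorem14 : (k : ℕ) → 2 ≤ k →
    ReconfIsoPath (compl (fan k)) (IsISet (compl (fan k))) (k ∸ 1) ×
    ReconfIsoPath (compl (fan k)) (IsAlphaSet (compl (fan k))) (k ∸ 1)
mainTheorem14 (suc (suc m)) (s≤s (s≤s z≤n)) =
  (hubEdge , hubEdge-isISet , hubEdge-injective , (λ _ → indepDom⇒hubEdge ∘ proj₁) , path⇔slide-hubEdge) ,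
  (hubEdge , hubEdge-isAlphaSet , hubEdge-injective , (λ _ → alphaSet⇒hubEdge) , path⇔slide-hubEdge)
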